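{- For $n\geq5$, the directed circuit $\overrightarrow{C_n}$ has exactly two trivial distance ideals over $\mathbb{Z}[x_1,\dots,x_n]$, i.e. $I_1(\overrightarrow{C_n})=I_2(\overrightarrow{C_n})=\langle1\rangle$ and $I_3(\overrightarrow{C_n})\neq\langle1\rangle$.
   Context: $\overrightarrow{C_n}$ has vertices $v_1,\dots,v_n$ and arcs $(v_i,v_{i+1})$ for $1\leq i<n$ and $(v_n,v_1)$; its distance matrix $D$ has $(i,j)$-entry $(j-i)\bmod n\in\{0,\dots,n-1\}$. With indeterminate $x_i$ attached to $v_i$, $D_X(\overrightarrow{C_n})=\operatorname{diag}(x_1,\dots,x_n)+D$, and the $k$-th distance ideal $I_k(\overrightarrow{C_n})$ is the ideal of $\mathbb{Z}[x_1,\dots,x_n]$ generated by all $k\times k$ minors of $D_X(\overrightarrow{C_n})$. An ideal is trivial if it equals $\langle 1\rangle$; the ideals satisfy $I_1\supseteq I_2\supseteq\cdots\supseteq I_n$. -}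

module Defs where

open import Data.Nat as ℕ using (ℕ; zero; suc; _≤ᵇ_; _∸_)
import Data.Nat.Properties as ℕP
open import Data.Integer as ℤ using (ℤ; +_; 0ℤ; 1ℤ)
open import Data.Fin as Fin using (Fin; toℕ; punchIn) renaming (_<_ to _<ᶠ_)
open import Data.Fin.Properties using () renaming (_≟_ to _≟ᶠ_)
open import Data.Vec using (Vec; replicate; zipWith; tabulate)
open import Data.Vec.Properties using (≡-dec)
open import Data.List using (List; []; _∷_; map; concatMap; foldr)
open import Data.Product using (Σ; _×_; _,_)
open import Data.Bool using (if_then_else_)
open import Relation.Nullary using (does)
open import Relation.Binary.PropositionalEquality using (_≡_)

-- The polynomial ring ℤ[x₁,…,xₙ]
-- A polynomial is a finite formal ℤ-linear combination of monomials;
-- a monomial is its exponent vector.  Two polynomials are equal when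
-- every monomial has the same (total) coefficient in both.

Mono : ℕ → Set
Mono n = Vec ℕ n

Poly : ℕ → Set
Poly n = List (ℤ × Mono n)

module _ {n : ℕ} where

  coeff : Poly n → Mono n → ℤ
  coeff []            m = 0ℤ
  coeff ((c , e) ∷ p) m =
    if does (≡-dec ℕP._≟_ e m) then c ℤ.+ coeff p m else coeff p m

  infix 4 _≈_
  _≈_ : Poly n → Poly n → Set
  p ≈ q = ∀ m → coeff p m ≡ coeff q m

  const : ℤ → Poly n
  const c = (c , replicate n 0) ∷ []

  0P 1P : Poly n
  0P = []
  1P = const 1ℤ

  var : Fin n → Poly n
  var i = (1ℤ , tabulate (λ j → if does (j ≟ᶠ i) then 1 else 0)) ∷ []

  infixl 6 _+P_
  infixl 7 _*P_
  _+P_ : Poly n → Poly n → Poly n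
  p +P q = Data.List._++_ p q

  -P_ : Poly n → Poly n
  -P_ p = map (λ { (c , e) → (ℤ.- c , e) }) p

  _*P_ : Poly n → Poly n → Poly n
  p *P q = concatMap (λ { (c , e) → map (λ { (d , f) → (c ℤ.* d , zipWith ℕ._+_ e f) }) q }) p

  sumP : List (Poly n) → Poly n
  sumP = foldr _+P_ 0P

  sumFin : (k : ℕ) → (Fin k → Poly n) → Poly n
  sumFin zero    f = 0P
  sumFin (suc k) f = f Fin.zero +P sumFin k (λ j → f (Fin.suc j))

  det : (k : ℕ) → (Fin k → Fin k → Poly n) → Poly n
  det zero    M = 1P
  det (suc k) M = sumFin (suc k) λ j →
    sign (toℕ j) (M Fin.zero j *P det k (λ a b → M (Fin.suc a) (punchIn j b)))
    where
    sign : ℕ → Poly n → Poly n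
    sign zero          p = p
    sign (suc zero)    p = -P p
    sign (suc (suc t)) p = sign t p

-- distance from v_i to v_j in the directed n-cycle: (j - i) mod n
dist : (n : ℕ) → Fin n → Fin n → ℕ
dist n i j = if toℕ i ≤ᵇ toℕ j then toℕ j ∸ toℕ i else (n ℕ.+ toℕ j) ∸ toℕ i

DX : (n : ℕ) → Fin n → Fin n → Poly n
DX n i j = (if does (i ≟ᶠ j) then var i else 0P) +P const (+ dist n i j)

-- a k-element subset of Fin n, listed increasingly
record Sel (k n : ℕ) : Set where
  field
    pick : Fin k → Fin n
    incr : ∀ {a b} → a <ᶠ b → pick a <ᶠ pick b
open Sel public

minor : ∀ {n} (k : ℕ) → (Fin n → Fin n → Poly n) → Sel k n → Sel k n → Poly n
minor k M r c = det k (λ a b → M (pick r a) (pick c b))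

-- An ideal I ⊆ ℤ[x₁,…,xₙ] is trivial iff 1 ∈ I.  Here I = I_k(C_n), generated
-- by all k×k minors of D_X, so 1 ∈ I_k iff 1 is a ℤ[x]-linear combination of
-- finitely many k×k minors.
TrivialDistIdeal : (n k : ℕ) → Set
TrivialDistIdeal n k =
  Σ (List (Poly n × Sel k n × Sel k n)) λ cs →
    sumP (map (λ { (c , r , s) → c *P minor k (DX n) r s }) cs) ≈ 1P

-- Taking constant terms (evaluating at x = 0) is a ring homomorphism ℤ[x₁,…,xₙ] → ℤ, so it maps
-- I₃ into the ideal of ℤ generated by the 3×3 minors of the distance matrix D.  Since
-- d(vᵢ, vⱼ) ≡ j − i (mod n), D is congruent modulo n to the matrix (j − i), which has rank at
-- most 2; so n divides every 3×3 minor of D and 1 ∉ I₃.  On the other side, D has the entry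
-- d(v₁, v₂) = 1, and rows {v₁, v₂} with columns {v₃, v₄} give the off-diagonal minor
-- det [[2, 3], [1, 2]] = 1, so I₁ = I₂ = ⟨1⟩.
module Submission where

open import Defs
open import Data.Nat using (ℕ; _≤_)
open import Data.Product using (_×_)
open import Relation.Nullary using (¬_)

open import Data.Bool using (true; false; if_then_else_; T)
open import Data.Fin using (Fin; zero; suc; toℕ; punchIn; #_) renaming (_<_ to _<ᶠ_)
open import Data.Fin.Properties using (toℕ<n) renaming (_≟_ to _≟ᶠ_)
open import Data.Integer using (ℤ; +_; 0ℤ; 1ℤ; _+_; _-_; -_; _*_)
open import Data.Integer.Divisibility.Signed
  using (_∣_; divides; ∣m∣n⇒∣m+n; ∣m∣n⇒∣m-n; ∣m⇒∣m*n; ∣n⇒∣m*n; ∣⇒∣ᵤ)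
import Data.Integer.Properties as ℤP
open import Data.Integer.Tactic.RingSolver using (solve-∀)
open import Data.List using ([]; _∷_; map)
open import Data.List.Properties using (++-identityʳ)
open import Data.List.Relation.Unary.All as All using (All; []; _∷_)
open import Data.List.Relation.Unary.All.Properties using (++⁺; map⁺)
open import Data.Nat as ℕ using (suc; _<_; s≤s)
import Data.Nat.Divisibility as ℕD
import Data.Nat.Properties as ℕP
open import Data.Product using (_,_; proj₂)
open import Data.Vec using (Vec; []; _∷_; replicate; zipWith; tabulate; lookup; head; tail)
open import Data.Vec.Properties using (≡-dec; zipWith-identityˡ; lookup∘tabulate; lookup-replicate)
open import Function using (_∘_)
open import Relation.Binary using (DecidableEquality)
open import Relation.Binary.PropositionalEquality
open import Relation.Nullary using (does; yes; no)
open import Relation.Nullary.Decidable using (dec-true; dec-false)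

open ≡-Reasoning

zipWith-+≡0⇒≡0ˡ : ∀ {k} (e f : Vec ℕ k) → zipWith ℕ._+_ e f ≡ replicate k 0 → e ≡ replicate k 0
zipWith-+≡0⇒≡0ˡ []      []      _  = refl
zipWith-+≡0⇒≡0ˡ (x ∷ e) (y ∷ f) eq =
  cong₂ Vec._∷_ (ℕP.m+n≡0⇒m≡0 x (cong head eq)) (zipWith-+≡0⇒≡0ˡ e f (cong tail eq))

removeRow₀Col : ∀ {A : Set} {k} → Fin (suc k) → (Fin (suc k) → Fin (suc k) → A) → Fin k → Fin k → A
removeRow₀Col j M a b = M (suc a) (punchIn j b)

det₂ : (Fin 2 → Fin 2 → ℤ) → ℤ
det₂ A = A (# 0) (# 0) * A (# 1) (# 1) - A (# 0) (# 1) * A (# 1) (# 0)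

-- Expanded along the first row in the same order as det.
det₃ : (Fin 3 → Fin 3 → ℤ) → ℤ
det₃ A = A (# 0) (# 0) * det₂ (removeRow₀Col (# 0) A)
       - A (# 0) (# 1) * det₂ (removeRow₀Col (# 1) A)
       + A (# 0) (# 2) * det₂ (removeRow₀Col (# 2) A)

-- The matrix (u b − v a) has rank at most 2.
det₃-differences : (u v : Fin 3 → ℤ) → det₃ (λ a b → u b - v a) ≡ 0ℤ
det₃-differences u v = expansion (u (# 0)) (u (# 1)) (u (# 2)) (v (# 0)) (v (# 1)) (v (# 2))
  where
  expansion : ∀ u₀ u₁ u₂ v₀ v₁ v₂ →
      (u₀ - v₀) * ((u₁ - v₁) * (u₂ - v₂) - (u₂ - v₁) * (u₁ - v₂))
    - (u₁ - v₀) * ((u₀ - v₁) * (u₂ - v₂) - (u₂ - v₁) * (u₀ - v₂))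
    + (u₂ - v₀) * ((u₀ - v₁) * (u₁ - v₂) - (u₁ - v₁) * (u₀ - v₂)) ≡ 0ℤ
  expansion = solve-∀

infix 4 _≡_mod_
record _≡_mod_ (a b m : ℤ) : Set where
  constructor ∣-difference
  field
    divides-difference : m ∣ a - b

open _≡_mod_

≡⇒≡-mod : ∀ {a b m} → a ≡ b → a ≡ b mod m
≡⇒≡-mod {a} refl = ∣-difference (divides 0ℤ (ℤP.+-inverseʳ a))

+-cong-mod : ∀ {a b c d m} → a ≡ b mod m → c ≡ d mod m → a + c ≡ b + d mod m
+-cong-mod {a} {b} {c} {d} (∣-difference m∣a-b) (∣-difference m∣c-d) =
  ∣-difference (subst (_ ∣_) (rearrange a b c d) (∣m∣n⇒∣m+n m∣a-b m∣c-d))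
  where
  rearrange : ∀ a b c d → (a - b) + (c - d) ≡ (a + c) - (b + d)
  rearrange = solve-∀

minus-cong-mod : ∀ {a b c d m} → a ≡ b mod m → c ≡ d mod m → a - c ≡ b - d mod m
minus-cong-mod {a} {b} {c} {d} (∣-difference m∣a-b) (∣-difference m∣c-d) =
  ∣-difference (subst (_ ∣_) (rearrange a b c d) (∣m∣n⇒∣m-n m∣a-b m∣c-d))
  where
  rearrange : ∀ a b c d → (a - b) - (c - d) ≡ (a - c) - (b - d)
  rearrange = solve-∀

*-cong-mod : ∀ {a b c d m} → a ≡ b mod m → c ≡ d mod m → a * c ≡ b * d mod m
*-cong-mod {a} {b} {c} {d} (∣-difference m∣a-b) (∣-difference m∣c-d) =
  ∣-difference (subst (_ ∣_) (rearrange a b c d) (∣m∣n⇒∣m+n (∣m⇒∣m*n c m∣a-b) (∣n⇒∣m*n b m∣c-d)))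
  where
  rearrange : ∀ a b c d → (a - b) * c + b * (c - d) ≡ a * c - b * d
  rearrange = solve-∀

det₂-cong-mod : ∀ {A B m} → (∀ a b → A a b ≡ B a b mod m) → det₂ A ≡ det₂ B mod m
det₂-cong-mod A≡B =
  minus-cong-mod (*-cong-mod (A≡B (# 0) (# 0)) (A≡B (# 1) (# 1)))
                 (*-cong-mod (A≡B (# 0) (# 1)) (A≡B (# 1) (# 0)))

det₃-cong-mod : ∀ {A B m} → (∀ a b → A a b ≡ B a b mod m) → det₃ A ≡ det₃ B mod m
det₃-cong-mod {A} {B} {m} A≡B =
  +-cong-mod (minus-cong-mod (cofactor (# 0)) (cofactor (# 1))) (cofactor (# 2))
  where
  cofactor : ∀ j → A (# 0) j * det₂ (removeRow₀Col j A) ≡ B (# 0) j * det₂ (removeRow₀Col j B) mod m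
  cofactor j = *-cong-mod (A≡B (# 0) j) (det₂-cong-mod λ a b → A≡B (suc a) (punchIn j b))

pos-∸ : ∀ {m n} → n ℕ.≤ m → + (m ℕ.∸ n) ≡ + m - + n
pos-∸ {m} {n} n≤m = sym (trans (ℤP.[+m]-[+n]≡m⊖n m n) (ℤP.⊖-≥ n≤m))

dist-≡-mod : ∀ n (i j : Fin n) → + dist n i j ≡ + toℕ j - + toℕ i mod + n
dist-≡-mod n i j with toℕ i ℕ.≤ᵇ toℕ j in i≤ᵇj
... | true  = ≡⇒≡-mod (pos-∸ (ℕP.≤ᵇ⇒≤ (toℕ i) (toℕ j) (subst T (sym i≤ᵇj) _)))
... | false = ∣-difference (divides 1ℤ (begin
    + (n ℕ.+ toℕ j ℕ.∸ toℕ i) - (+ toℕ j - + toℕ i)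
      ≡⟨ cong (_- (+ toℕ j - + toℕ i)) (pos-∸ i≤n+j) ⟩
    + (n ℕ.+ toℕ j) - + toℕ i - (+ toℕ j - + toℕ i)
      ≡⟨ cong (λ x → x - + toℕ i - (+ toℕ j - + toℕ i)) (ℤP.pos-+ n (toℕ j)) ⟩
    + n + + toℕ j - + toℕ i - (+ toℕ j - + toℕ i)
      ≡⟨ cancel (+ n) (+ toℕ j) (+ toℕ i) ⟩
    1ℤ * + n
      ∎))
  where
  i≤n+j : toℕ i ℕ.≤ n ℕ.+ toℕ j
  i≤n+j = ℕP.≤-trans (ℕP.<⇒≤ (toℕ<n i)) (ℕP.m≤m+n n (toℕ j))
  cancel : ∀ a b c → a + b - c - (b - c) ≡ 1ℤ * a
  cancel = solve-∀

module _ {n : ℕ} where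

  zeroExp : Mono n
  zeroExp = replicate n 0

  constantTerm : Poly n → ℤ
  constantTerm p = coeff p zeroExp

  _≟ᵐ_ : DecidableEquality (Mono n)
  _≟ᵐ_ = ≡-dec ℕP._≟_

  coeff-∷-≡ : ∀ c e (p : Poly n) → coeff ((c , e) ∷ p) e ≡ c + coeff p e
  coeff-∷-≡ c e p rewrite dec-true (e ≟ᵐ e) refl = refl

  coeff-∷-≢ : ∀ c e {m} (p : Poly n) → e ≢ m → coeff ((c , e) ∷ p) m ≡ coeff p m
  coeff-∷-≢ c e {m} p e≢m rewrite dec-false (e ≟ᵐ m) e≢m = refl

  coeff-+P : ∀ (p q : Poly n) m → coeff (p +P q) m ≡ coeff p m + coeff q m
  coeff-+P []            q m = sym (ℤP.+-identityˡ _)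
  coeff-+P ((c , e) ∷ p) q m with does (e ≟ᵐ m)
  ... | true  = trans (cong (_+_ c) (coeff-+P p q m)) (sym (ℤP.+-assoc c _ _))
  ... | false = coeff-+P p q m

  coeff--P : ∀ (p : Poly n) m → coeff (-P p) m ≡ - coeff p m
  coeff--P []            m = refl
  coeff--P ((c , e) ∷ p) m with does (e ≟ᵐ m)
  ... | true  = trans (cong (_+_ (- c)) (coeff--P p m)) (sym (ℤP.neg-distrib-+ c _))
  ... | false = coeff--P p m

  constantTerm-const : ∀ c → constantTerm (const c) ≡ c
  constantTerm-const c = trans (coeff-∷-≡ c zeroExp []) (ℤP.+-identityʳ c)

  constantTerm-var : ∀ i → constantTerm (var i) ≡ 0ℤ
  constantTerm-var i = coeff-∷-≢ 1ℤ (tabulate δᵢ) [] λ eq → ℕP.1+n≢0 (begin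
    1                       ≡⟨ cong (if_then 1 else 0) (sym (dec-true (i ≟ᶠ i) refl)) ⟩
    δᵢ i                    ≡⟨ sym (lookup∘tabulate δᵢ i) ⟩
    lookup (tabulate δᵢ) i  ≡⟨ cong (λ e → lookup e i) eq ⟩
    lookup zeroExp i        ≡⟨ lookup-replicate i 0 ⟩
    0                       ∎)
    where
    δᵢ : Fin n → ℕ
    δᵢ j = if does (j ≟ᶠ i) then 1 else 0

  constantTerm-DX : ∀ i j → constantTerm (DX n i j) ≡ + dist n i j
  constantTerm-DX i j = begin
    constantTerm (diagonal +P const (+ dist n i j))
      ≡⟨ coeff-+P diagonal (const (+ dist n i j)) zeroExp ⟩
    constantTerm diagonal + constantTerm (const (+ dist n i j))
      ≡⟨ cong₂ _+_ constantTerm-diagonal (constantTerm-const (+ dist n i j)) ⟩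
    0ℤ + + dist n i j
      ≡⟨ ℤP.+-identityˡ (+ dist n i j) ⟩
    + dist n i j
      ∎
    where
    diagonal : Poly n
    diagonal = if does (i ≟ᶠ j) then var i else 0P
    constantTerm-diagonal : constantTerm diagonal ≡ 0ℤ
    constantTerm-diagonal with does (i ≟ᶠ j)
    ... | true  = constantTerm-var i
    ... | false = refl

  -- ((c , e) ∷ p) *P q unfolds definitionally to (c , e) *ᵗ q +P p *P q.
  infixr 7 _*ᵗ_
  _*ᵗ_ : ℤ × Mono n → Poly n → Poly n
  (c , e) *ᵗ q = map (λ (d , f) → (c * d , zipWith ℕ._+_ e f)) q

  constantTerm-*ᵗ-zeroExp : ∀ c (q : Poly n) → constantTerm ((c , zeroExp) *ᵗ q) ≡ c * constantTerm q
  constantTerm-*ᵗ-zeroExp c []            = sym (ℤP.*-zeroʳ c)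
  constantTerm-*ᵗ-zeroExp c ((d , f) ∷ q) with f ≟ᵐ zeroExp
  ... | yes refl = begin
    constantTerm ((c * d , zipWith ℕ._+_ zeroExp zeroExp) ∷ (c , zeroExp) *ᵗ q)
      ≡⟨ cong (λ e → constantTerm ((c * d , e) ∷ (c , zeroExp) *ᵗ q))
              (zipWith-identityˡ ℕP.+-identityˡ zeroExp) ⟩
    constantTerm ((c * d , zeroExp) ∷ (c , zeroExp) *ᵗ q)
      ≡⟨ coeff-∷-≡ (c * d) zeroExp ((c , zeroExp) *ᵗ q) ⟩
    c * d + constantTerm ((c , zeroExp) *ᵗ q)
      ≡⟨ cong (_+_ (c * d)) (constantTerm-*ᵗ-zeroExp c q) ⟩
    c * d + c * constantTerm q
      ≡⟨ sym (ℤP.*-distribˡ-+ c d (constantTerm q)) ⟩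
    c * (d + constantTerm q)
      ∎
  ... | no f≢0 = begin
    constantTerm ((c * d , zipWith ℕ._+_ zeroExp f) ∷ (c , zeroExp) *ᵗ q)
      ≡⟨ coeff-∷-≢ (c * d) (zipWith ℕ._+_ zeroExp f) ((c , zeroExp) *ᵗ q)
                   (f≢0 ∘ trans (sym (zipWith-identityˡ ℕP.+-identityˡ f))) ⟩
    constantTerm ((c , zeroExp) *ᵗ q)
      ≡⟨ constantTerm-*ᵗ-zeroExp c q ⟩
    c * constantTerm q
      ∎

  constantTerm-*ᵗ-≢ : ∀ c {e} (q : Poly n) → e ≢ zeroExp → constantTerm ((c , e) *ᵗ q) ≡ 0ℤ
  constantTerm-*ᵗ-≢ c     []            e≢0 = refl
  constantTerm-*ᵗ-≢ c {e} ((d , f) ∷ q) e≢0 =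
    trans (coeff-∷-≢ (c * d) (zipWith ℕ._+_ e f) ((c , e) *ᵗ q) (e≢0 ∘ zipWith-+≡0⇒≡0ˡ e f))
          (constantTerm-*ᵗ-≢ c q e≢0)

  constantTerm-*P : ∀ (p q : Poly n) → constantTerm (p *P q) ≡ constantTerm p * constantTerm q
  constantTerm-*P []            q = refl
  constantTerm-*P ((c , e) ∷ p) q with e ≟ᵐ zeroExp
  ... | yes refl = begin
    constantTerm ((c , zeroExp) *ᵗ q +P p *P q)
      ≡⟨ coeff-+P ((c , zeroExp) *ᵗ q) (p *P q) zeroExp ⟩
    constantTerm ((c , zeroExp) *ᵗ q) + constantTerm (p *P q)
      ≡⟨ cong₂ _+_ (constantTerm-*ᵗ-zeroExp c q) (constantTerm-*P p q) ⟩
    c * constantTerm q + constantTerm p * constantTerm q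
      ≡⟨ sym (ℤP.*-distribʳ-+ (constantTerm q) c (constantTerm p)) ⟩
    (c + constantTerm p) * constantTerm q
      ∎
  ... | no e≢0 = begin
    constantTerm ((c , e) *ᵗ q +P p *P q)
      ≡⟨ coeff-+P ((c , e) *ᵗ q) (p *P q) zeroExp ⟩
    constantTerm ((c , e) *ᵗ q) + constantTerm (p *P q)
      ≡⟨ cong₂ _+_ (constantTerm-*ᵗ-≢ c q e≢0) (constantTerm-*P p q) ⟩
    0ℤ + constantTerm p * constantTerm q
      ≡⟨ ℤP.+-identityˡ (constantTerm p * constantTerm q) ⟩
    constantTerm p * constantTerm q
      ∎

  constantTerm-*P-≡ : ∀ (p q : Poly n) {a b} →
    constantTerm p ≡ a → constantTerm q ≡ b → constantTerm (p *P q) ≡ a * b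
  constantTerm-*P-≡ p q refl refl = constantTerm-*P p q

  IsConstant : Poly n → Set
  IsConstant = All ((_≡ zeroExp) ∘ proj₂)

  const-isConstant : ∀ c → IsConstant (const c)
  const-isConstant c = refl ∷ []

  -P-isConstant : ∀ {p} → IsConstant p → IsConstant (-P p)
  -P-isConstant = map⁺

  *P-isConstant : ∀ {p q} → IsConstant p → IsConstant q → IsConstant (p *P q)
  *P-isConstant {[]}          []          _  = []
  *P-isConstant {(c , _) ∷ p} (refl ∷ cp) cq = ++⁺ (map⁺ (All.map exponent cq)) (*P-isConstant cp cq)
    where
    exponent : ∀ {f} → f ≡ zeroExp → zipWith ℕ._+_ zeroExp f ≡ zeroExp
    exponent refl = zipWith-identityˡ ℕP.+-identityˡ zeroExp

  coeff-isConstant : ∀ {p m} → IsConstant p → zeroExp ≢ m → coeff p m ≡ 0ℤ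
  coeff-isConstant                []          0≢m = refl
  coeff-isConstant {(c , _) ∷ p} (refl ∷ cp) 0≢m =
    trans (coeff-∷-≢ c zeroExp p 0≢m) (coeff-isConstant cp 0≢m)

  isConstant⇒≈const : ∀ {p} → IsConstant p → p ≈ const (constantTerm p)
  isConstant⇒≈const {p} cp m with zeroExp ≟ᵐ m
  ... | yes refl = sym (ℤP.+-identityʳ (constantTerm p))
  ... | no 0≢m   = coeff-isConstant cp 0≢m

  det₁-isConstant : ∀ (M : Fin 1 → Fin 1 → Poly n) → (∀ a b → IsConstant (M a b)) → IsConstant (det 1 M)
  det₁-isConstant M const-M = ++⁺ (*P-isConstant (const-M (# 0) (# 0)) (const-isConstant 1ℤ)) []

  det₂-isConstant : ∀ (M : Fin 2 → Fin 2 → Poly n) → (∀ a b → IsConstant (M a b)) → IsConstant (det 2 M)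
  det₂-isConstant M const-M = ++⁺ (cofactor (# 0)) (++⁺ (-P-isConstant (cofactor (# 1))) [])
    where
    cofactor : ∀ j → IsConstant (M (# 0) j *P det 1 (removeRow₀Col j M))
    cofactor j = *P-isConstant (const-M (# 0) j)
      (det₁-isConstant (removeRow₀Col j M) λ a b → const-M (suc a) (punchIn j b))

  constantTerm-det₁ : ∀ (M : Fin 1 → Fin 1 → Poly n) {A : Fin 1 → Fin 1 → ℤ} →
    (∀ a b → constantTerm (M a b) ≡ A a b) → constantTerm (det 1 M) ≡ A (# 0) (# 0)
  constantTerm-det₁ M {A} ct≡A = begin
    constantTerm (M (# 0) (# 0) *P 1P +P 0P)
      ≡⟨ cong constantTerm (++-identityʳ (M (# 0) (# 0) *P 1P)) ⟩
    constantTerm (M (# 0) (# 0) *P 1P)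
      ≡⟨ constantTerm-*P-≡ (M (# 0) (# 0)) 1P (ct≡A (# 0) (# 0)) (constantTerm-const 1ℤ) ⟩
    A (# 0) (# 0) * 1ℤ
      ≡⟨ ℤP.*-identityʳ (A (# 0) (# 0)) ⟩
    A (# 0) (# 0)
      ∎

  constantTerm-det₂ : ∀ (M : Fin 2 → Fin 2 → Poly n) {A : Fin 2 → Fin 2 → ℤ} →
    (∀ a b → constantTerm (M a b) ≡ A a b) → constantTerm (det 2 M) ≡ det₂ A
  constantTerm-det₂ M {A} ct≡A = begin
    constantTerm (summand (# 0) +P (-P summand (# 1) +P 0P))
      ≡⟨ coeff-+P (summand (# 0)) (-P summand (# 1) +P 0P) zeroExp ⟩
    constantTerm (summand (# 0)) + constantTerm (-P summand (# 1) +P 0P)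
      ≡⟨ cong (_+_ (constantTerm (summand (# 0)))) (cong constantTerm (++-identityʳ (-P summand (# 1)))) ⟩
    constantTerm (summand (# 0)) + constantTerm (-P summand (# 1))
      ≡⟨ cong (_+_ (constantTerm (summand (# 0)))) (coeff--P (summand (# 1)) zeroExp) ⟩
    constantTerm (summand (# 0)) - constantTerm (summand (# 1))
      ≡⟨ cong₂ _-_ (cofactor (# 0)) (cofactor (# 1)) ⟩
    det₂ A
      ∎
    where
    summand : Fin 2 → Poly n
    summand j = M (# 0) j *P det 1 (removeRow₀Col j M)
    cofactor : ∀ j → constantTerm (summand j) ≡ A (# 0) j * removeRow₀Col j A (# 0) (# 0)
    cofactor j = constantTerm-*P-≡ (M (# 0) j) (det 1 (removeRow₀Col j M)) (ct≡A (# 0) j)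
      (constantTerm-det₁ (removeRow₀Col j M) λ a b → ct≡A (suc a) (punchIn j b))

  constantTerm-det₃ : ∀ (M : Fin 3 → Fin 3 → Poly n) {A : Fin 3 → Fin 3 → ℤ} →
    (∀ a b → constantTerm (M a b) ≡ A a b) → constantTerm (det 3 M) ≡ det₃ A
  constantTerm-det₃ M {A} ct≡A = begin
    constantTerm (summand (# 0) +P (-P summand (# 1) +P (summand (# 2) +P 0P)))
      ≡⟨ coeff-+P (summand (# 0)) (-P summand (# 1) +P (summand (# 2) +P 0P)) zeroExp ⟩
    t (# 0) + constantTerm (-P summand (# 1) +P (summand (# 2) +P 0P))
      ≡⟨ cong (_+_ (t (# 0))) (coeff-+P (-P summand (# 1)) (summand (# 2) +P 0P) zeroExp) ⟩
    t (# 0) + (constantTerm (-P summand (# 1)) + constantTerm (summand (# 2) +P 0P))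
      ≡⟨ cong₂ (λ x y → t (# 0) + (x + y))
               (coeff--P (summand (# 1)) zeroExp) (cong constantTerm (++-identityʳ (summand (# 2)))) ⟩
    t (# 0) + (- t (# 1) + t (# 2))
      ≡⟨ sym (ℤP.+-assoc (t (# 0)) (- t (# 1)) (t (# 2))) ⟩
    t (# 0) - t (# 1) + t (# 2)
      ≡⟨ cong₂ _+_ (cong₂ _-_ (cofactor (# 0)) (cofactor (# 1))) (cofactor (# 2)) ⟩
    det₃ A
      ∎
    where
    summand : Fin 3 → Poly n
    summand j = M (# 0) j *P det 2 (removeRow₀Col j M)
    t : Fin 3 → ℤ
    t j = constantTerm (summand j)
    cofactor : ∀ j → t j ≡ A (# 0) j * det₂ (removeRow₀Col j A)
    cofactor j = constantTerm-*P-≡ (M (# 0) j) (det 2 (removeRow₀Col j M)) (ct≡A (# 0) j)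
      (constantTerm-det₂ (removeRow₀Col j M) λ a b → ct≡A (suc a) (punchIn j b))

  constantTerm-∣-*P : ∀ {m} (p : Poly n) {q} → m ∣ constantTerm q → m ∣ constantTerm (p *P q)
  constantTerm-∣-*P {m} p {q} m∣q =
    subst (m ∣_) (sym (constantTerm-*P p q)) (∣n⇒∣m*n (constantTerm p) m∣q)

  constantTerm-∣-sumP : ∀ {A : Set} {m} {F : A → Poly n} xs →
    (∀ x → m ∣ constantTerm (F x)) → m ∣ constantTerm (sumP (map F xs))
  constantTerm-∣-sumP             []       _   = divides 0ℤ refl
  constantTerm-∣-sumP {m = m} {F} (x ∷ xs) m∣F =
    subst (m ∣_) (sym (coeff-+P (F x) (sumP (map F xs)) zeroExp))
          (∣m∣n⇒∣m+n (m∣F x) (constantTerm-∣-sumP xs m∣F))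

singleton : ∀ {n} → Fin n → Sel 1 n
singleton i = record { pick = λ _ → i ; incr = λ { {zero} {zero} () } }

pair : ∀ {n} (i j : Fin n) → i <ᶠ j → Sel 2 n
pair {n} i j i<j = record { pick = pick₂ ; incr = incr₂ }
  where
  pick₂ : Fin 2 → Fin n
  pick₂ zero    = i
  pick₂ (suc _) = j
  incr₂ : ∀ {a b} → a <ᶠ b → pick₂ a <ᶠ pick₂ b
  incr₂ {zero}     {zero}     ()
  incr₂ {zero}     {suc zero} _ = i<j
  incr₂ {suc zero} {zero}     ()
  incr₂ {suc zero} {suc zero} (s≤s ())

constant-unit-minor⇒trivial : ∀ {n k} (r s : Sel k n) → IsConstant (minor k (DX n) r s) →
  constantTerm (minor k (DX n) r s) ≡ 1ℤ → TrivialDistIdeal n k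
constant-unit-minor⇒trivial {n} {k} r s const-μ ct-μ≡1 = ((1P , r , s) ∷ []) , λ m → begin
  coeff (1P *P μ +P 0P) m
    ≡⟨ cong (λ p → coeff p m) (++-identityʳ (1P *P μ)) ⟩
  coeff (1P *P μ) m
    ≡⟨ isConstant⇒≈const (*P-isConstant (const-isConstant 1ℤ) const-μ) m ⟩
  coeff (const (constantTerm (1P *P μ))) m
    ≡⟨ cong (λ c → coeff (const c) m) (constantTerm-*P-≡ 1P μ (constantTerm-const {n} 1ℤ) ct-μ≡1) ⟩
  coeff 1P m
    ∎
  where
  μ : Poly n
  μ = minor k (DX n) r s

trivialDistIdeal₁ : ∀ {n} → 2 ≤ n → TrivialDistIdeal n 1
trivialDistIdeal₁ {n} (s≤s (s≤s _)) = constant-unit-minor⇒trivial (singleton (# 0)) (singleton (# 1))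
  (det₁-isConstant M λ _ _ → const-isConstant 1ℤ)
  (constantTerm-det₁ M λ _ _ → constantTerm-DX {n} (# 0) (# 1))
  where
  M : Fin 1 → Fin 1 → Poly n
  M _ _ = DX n (# 0) (# 1)

trivialDistIdeal₂ : ∀ {n} → 4 ≤ n → TrivialDistIdeal n 2
trivialDistIdeal₂ {n} (s≤s (s≤s (s≤s (s≤s _)))) = constant-unit-minor⇒trivial rows cols
  (det₂-isConstant M entries-constant)
  (constantTerm-det₂ M λ a b → constantTerm-DX (pick rows a) (pick cols b))
  where
  rows cols : Sel 2 n
  rows = pair (# 0) (# 1) (ℕP.n<1+n 0)
  cols = pair (# 2) (# 3) (ℕP.n<1+n 2)
  M : Fin 2 → Fin 2 → Poly n
  M a b = DX n (pick rows a) (pick cols b)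
  -- Rows and columns are disjoint, so every entry reduces to a constant polynomial.
  entries-constant : ∀ a b → IsConstant (M a b)
  entries-constant zero    zero    = const-isConstant _
  entries-constant zero    (suc _) = const-isConstant _
  entries-constant (suc _) zero    = const-isConstant _
  entries-constant (suc _) (suc _) = const-isConstant _

n∣constantTerm-minor₃ : ∀ {n} (r s : Sel 3 n) → + n ∣ constantTerm (minor 3 (DX n) r s)
n∣constantTerm-minor₃ {n} r s = subst (+ n ∣_) det₃D≡constantTerm (divides-difference det₃D≡0)
  where
  D : Fin 3 → Fin 3 → ℤ
  D a b = + dist n (pick r a) (pick s b)
  det₃D≡constantTerm : det₃ D - 0ℤ ≡ constantTerm (minor 3 (DX n) r s)
  det₃D≡constantTerm = trans (ℤP.+-identityʳ (det₃ D))
    (sym (constantTerm-det₃ (λ a b → DX n (pick r a) (pick s b)) λ a b → constantTerm-DX (pick r a) (pick s b)))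
  det₃D≡0 : det₃ D ≡ 0ℤ mod + n
  det₃D≡0 = subst (λ x → det₃ D ≡ x mod + n) (det₃-differences (+_ ∘ toℕ ∘ pick s) (+_ ∘ toℕ ∘ pick r))
    (det₃-cong-mod λ a b → dist-≡-mod n (pick r a) (pick s b))

¬trivialDistIdeal₃ : ∀ {n} → 1 < n → ¬ TrivialDistIdeal n 3
¬trivialDistIdeal₃ {n} 1<n (cs , combination≈1) = ℕP.<⇒≢ 1<n (sym (ℕD.∣1⇒≡1 (∣⇒∣ᵤ n∣1)))
  where
  n∣1 : + n ∣ 1ℤ
  n∣1 = subst (+ n ∣_) (trans (combination≈1 zeroExp) (constantTerm-const {n} 1ℤ))
    (constantTerm-∣-sumP cs λ (c , r , s) → constantTerm-∣-*P c (n∣constantTerm-minor₃ r s))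

corollary26 : (n : ℕ) → 5 ≤ n →
    TrivialDistIdeal n 1 × TrivialDistIdeal n 2 × ¬ TrivialDistIdeal n 3
corollary26 n 5≤n =
  trivialDistIdeal₁ (ℕP.≤-trans (ℕP.m≤m+n 2 3) 5≤n) ,
  trivialDistIdeal₂ (ℕP.≤-trans (ℕP.m≤m+n 4 1) 5≤n) ,
  ¬trivialDistIdeal₃ (ℕP.≤-trans (ℕP.m≤m+n 2 3) 5≤n)
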